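{- Let $n\ge1$ and $k,\ell,m\ge0$ with $\ell\ge1$ and $k+\ell+m=n$. The number of circular complete configurations of length $n$ having exactly $\ell$ $\times\times$-columns, $k$ black particles in the top row and $m$ white particles in the top row is $$|\widehat\Omega^\ell_{k,m}|=\binom{n}{k}\binom{n}{m}.$$
   Context: A circular complete configuration of length $n$ consists of $n$ columns occupying fixed positions $1,\dots,n$ arranged on a circle (position $n$ followed clockwise by position $1$; configurations are not identified up to rotation), each column having a top and a bottom cell each containing a black ($\bullet$), white ($\circ$) or neutral ($\times$) particle, such that a top cell contains $\times$ iff the bottom cell of the same column does, and each maximal clockwise run of consecutive columns without $\times$ lying between two consecutive $\times\times$-columns (when there is a single $\times\times$-column, the run of the other $n-1$ columns starting just clockwise after it; runs may be empty) satisfies balance (as many black as white particles in the run, both rows together) and positivity (every initial segment of the run, read clockwise, has at least as many black as white particles). -}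

module Defs where

open import Data.Nat using (ℕ; zero; suc; _+_; _≤_)
open import Data.List using (List; []; _∷_; _++_; reverse; inits)
open import Data.List.Relation.Unary.All using (All)
open import Data.Vec using (Vec; toList)
open import Data.Product using (_×_; Σ)
open import Relation.Binary.PropositionalEquality using (_≡_)

data Colour : Set where
  black white : Colour

-- A column: either the neutral column ×× (top is × iff bottom is ×),
-- or a column with a non-neutral top particle and a non-neutral bottom particle.
data Column : Set where
  xx  : Column
  col : (top bottom : Colour) → Column

blacksC : Column → ℕ
blacksC xx = 0
blacksC (col t b) = f t + f b
  where f : Colour → ℕ
        f black = 1
        f white = 0

whitesC : Column → ℕ
whitesC xx = 0
whitesC (col t b) = f t + f b
  where f : Colour → ℕ
        f black = 0
        f white = 1

blacks : List Column → ℕ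
blacks [] = 0
blacks (c ∷ cs) = blacksC c + blacks cs

whites : List Column → ℕ
whites [] = 0
whites (c ∷ cs) = whitesC c + whites cs

countXX : List Column → ℕ
countXX [] = 0
countXX (xx ∷ cs) = suc (countXX cs)
countXX (col _ _ ∷ cs) = countXX cs

topBlacks : List Column → ℕ
topBlacks [] = 0
topBlacks (col black _ ∷ cs) = suc (topBlacks cs)
topBlacks (_ ∷ cs) = topBlacks cs

topWhites : List Column → ℕ
topWhites [] = 0
topWhites (col white _ ∷ cs) = suc (topWhites cs)
topWhites (_ ∷ cs) = topWhites cs

-- The circular word read clockwise starting just after the first ×× column
-- (positions first+1, …, n, 1, …, first-1); the first ×× column itself is
-- dropped.  (If there is no ×× column the result is irrelevant.)
afterFirstXX : List Column → List Column → List Column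
afterFirstXX acc [] = reverse acc
afterFirstXX acc (xx ∷ post) = post ++ reverse acc
afterFirstXX acc (col t b ∷ post) = afterFirstXX (col t b ∷ acc) post

splitXX : List Column → List (List Column)
splitXX [] = [] ∷ []
splitXX (xx ∷ cs) = [] ∷ splitXX cs
splitXX (col t b ∷ cs) with splitXX cs
... | [] = (col t b ∷ []) ∷ []
... | r ∷ rs = (col t b ∷ r) ∷ rs

-- The maximal runs of columns without × between consecutive ×× columns
-- of a circular configuration (containing at least one ×× column),
-- each read clockwise.
runs : List Column → List (List Column)
runs w = splitXX (afterFirstXX [] w)

Balanced : List Column → Set
Balanced r = blacks r ≡ whites r

Positive : List Column → Set
Positive r = All (λ p → whites p ≤ blacks p) (inits r)

GoodRun : List Column → Set
GoodRun r = Balanced r × Positive r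

-- circular configurations of length n (columns at fixed positions 1..n)
Config : ℕ → Set
Config n = Vec Column n

InOmega : (n k ℓ m : ℕ) → Config n → Set
InOmega n k ℓ m c =
  countXX (toList c) ≡ ℓ × topBlacks (toList c) ≡ k × topWhites (toList c) ≡ m
  × All GoodRun (runs (toList c))

Omega : (n k ℓ m : ℕ) → Set
Omega n k ℓ m = Σ (Config n) (InOmega n k ℓ m)

{-# OPTIONS --safe #-}
-- Remember of each column only its shape: whether its top and its bottom particle are black.
-- This forgets exactly the difference between ∘∘ and ×× columns, and the shape vectors with k
-- black tops and m black bottoms are pairs of a k-subset and an m-subset of the n positions.
-- Read clockwise, a configuration is a walk on ℕ (•• up, ∘∘ down, •∘ and ∘• flat, ×× only at
-- level 0), and its runs are balanced and positive exactly when this walk is closed and meets a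
-- ×× column.  Over a fixed shape the walk from a start level h is forced (∘∘ above 0, ×× at 0);
-- its end level L h is monotone with L (h + d) ≤ d + L h, strictly once the walk from h meets ××.
-- Hence L has at most one fixed point whose walk meets ××.  It has one, because the counts give
-- the shape ℓ more (false , false) than (true , true) entries, and the walk at any fixed point
-- then meets exactly ℓ ×× columns.  So every admissible shape carries exactly one configuration.
module Submission where

open import Defs
open import Data.Nat using (ℕ; zero; suc; _+_; _*_; _∸_; _≤_; _<_; _≥_; z≤n; s≤s)
open import Data.Nat.Properties
open import Data.Nat.Combinatorics using (_C_; nCk+nC[k+1]≡[n+1]C[k+1])
open import Data.Bool using (Bool; true; false; not; _∧_; _∨_)
open import Data.Fin using (Fin)
open import Data.Fin.Properties using (0↔⊥; 1↔⊤; +↔⊎; *↔×)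
open import Data.List using (List; []; _∷_; _++_; reverse; inits)
open import Data.List.Properties using (++-assoc; ++-identityʳ; unfold-reverse)
open import Data.List.Relation.Unary.All as All using (All; []; _∷_)
open import Data.List.Relation.Unary.All.Properties using (map⁺; map⁻)
open import Data.Vec using (Vec; []; _∷_; toList; map; zip; countᵇ)
open import Data.Vec.Properties using (map-proj₁-zip; map-proj₂-zip; map-<,>-zip; map-id)
open import Data.Product using (Σ; ∃-syntax; _×_; _,_; proj₁; proj₂; uncurry)
open import Data.Product.Function.NonDependent.Propositional using (_×-↔_)
open import Data.Sum using (_⊎_; inj₁; inj₂)
open import Data.Sum.Function.Propositional using (_⊎-↔_)
open import Data.Empty using (⊥; ⊥-elim)
open import Data.Unit using (⊤; tt)
open import Function using (id; _∘_)
open import Function.Bundles using (_↔_; _⇔_; mk↔ₛ′; mk⇔; Equivalence)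
open import Function.Properties.Inverse using (↔-trans; ↔-sym)
import Function.Properties.Equivalence as ⇔
open import Relation.Binary.PropositionalEquality
open import Relation.Binary.Definitions using (tri<; tri≈; tri>)
open import Data.Nat.Tactic.RingSolver using (solve-∀)
open import Algebra.Properties.CommutativeSemigroup +-commutativeSemigroup using (x∙yz≈y∙xz)

variable
  n k h h′ h″ : ℕ
  c : Column
  cs ds : List Column

Choose : ℕ → ℕ → Set
Choose n k = Σ (Vec Bool n) (λ v → countᵇ id v ≡ k)

Σ-≡-irrelevant : {A : Set} {P : A → Set} {x y : A} {p : P x} {q : P y} →
                 (∀ {z} (u v : P z) → u ≡ v) → x ≡ y → (x , p) ≡ (y , q)
Σ-≡-irrelevant irr refl = cong (_ ,_) (irr _ _)

Choose[0,0]↔⊤ : Choose 0 0 ↔ ⊤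
Choose[0,0]↔⊤ = mk↔ₛ′ (λ _ → tt) (λ _ → [] , refl) (λ _ → refl) (λ { ([] , refl) → refl })

Choose[0,1+k]↔⊥ : Choose 0 (suc k) ↔ ⊥
Choose[0,1+k]↔⊥ = mk↔ₛ′ (λ { ([] , ()) }) (λ ()) (λ ()) (λ { ([] , ()) })

Choose[1+n,0]↔Choose[n,0] : Choose (suc n) 0 ↔ Choose n 0
Choose[1+n,0]↔Choose[n,0] = mk↔ₛ′ tail (λ (v , p) → false ∷ v , p) (λ _ → refl) λ { (false ∷ _ , _) → refl }
  where
  tail : Choose (suc _) 0 → Choose _ 0
  tail (false ∷ v , p) = v , p

Choose[1+n,1+k]↔⊎ : Choose (suc n) (suc k) ↔ (Choose n k ⊎ Choose n (suc k))
Choose[1+n,1+k]↔⊎ = mk↔ₛ′ split join split∘join join∘split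
  where
  split : Choose (suc _) (suc _) → Choose _ _ ⊎ Choose _ (suc _)
  split (true ∷ v , p) = inj₁ (v , suc-injective p)
  split (false ∷ v , p) = inj₂ (v , p)
  join : Choose _ _ ⊎ Choose _ (suc _) → Choose (suc _) (suc _)
  join (inj₁ (v , p)) = true ∷ v , cong suc p
  join (inj₂ (v , p)) = false ∷ v , p
  split∘join : ∀ x → split (join x) ≡ x
  split∘join (inj₁ (v , p)) = cong inj₁ (Σ-≡-irrelevant ≡-irrelevant refl)
  split∘join (inj₂ (v , p)) = refl
  join∘split : ∀ x → join (split x) ≡ x
  join∘split (true ∷ v , p) = Σ-≡-irrelevant ≡-irrelevant refl
  join∘split (false ∷ v , p) = refl

Choose↔Fin : ∀ n k → Choose n k ↔ Fin (n C k)
Choose↔Fin zero zero = ↔-trans Choose[0,0]↔⊤ (↔-sym 1↔⊤)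
Choose↔Fin zero (suc k) = ↔-trans Choose[0,1+k]↔⊥ (↔-sym 0↔⊥)
Choose↔Fin (suc n) zero = ↔-trans Choose[1+n,0]↔Choose[n,0] (Choose↔Fin n zero)
Choose↔Fin (suc n) (suc k) =
  subst (λ N → Choose (suc n) (suc k) ↔ Fin N) (nCk+nC[k+1]≡[n+1]C[k+1] n k)
    (↔-trans Choose[1+n,1+k]↔⊎ (↔-trans (Choose↔Fin n k ⊎-↔ Choose↔Fin n (suc k)) (↔-sym +↔⊎)))

-- The level is half the surplus of black over white particles since the last ×× column.
data Step : ℕ → Column → ℕ → Set where
  neutral : Step 0 xx 0
  up      : Step h (col black black) (suc h)
  down    : Step (suc h) (col white white) h
  bw      : Step h (col black white) h
  wb      : Step h (col white black) h

data Walk : ℕ → List Column → ℕ → Set where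
  []  : Walk h [] h
  _∷_ : ∀ {h h′ h″ c cs} → Step h c h′ → Walk h′ cs h″ → Walk h (c ∷ cs) h″

walk-++⁺ : Walk h cs h′ → Walk h′ ds h″ → Walk h (cs ++ ds) h″
walk-++⁺ []      w′ = w′
walk-++⁺ (s ∷ w) w′ = s ∷ walk-++⁺ w w′

walk-++⁻ : ∀ cs → Walk h (cs ++ ds) h″ → ∃[ h′ ] Walk h cs h′ × Walk h′ ds h″
walk-++⁻ []       w       = _ , [] , w
walk-++⁻ (c ∷ cs) (s ∷ w) = let h′ , w₁ , w₂ = walk-++⁻ cs w in h′ , s ∷ w₁ , w₂

walk-xx⁻ : ∀ cs → Walk 0 (cs ++ xx ∷ ds) h → Walk 0 cs 0 × Walk 0 ds h
walk-xx⁻ cs w with walk-++⁻ cs w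
... | _ , w₁ , neutral ∷ w₂ = w₁ , w₂

double-suc : ∀ h → suc h + suc h ≡ 2 + (h + h)
double-suc h = cong suc (+-suc h h)

step-balance : Step h c h′ → ∀ y → h + h + (blacksC c + y) ≡ whitesC c + (h′ + h′ + y)
step-balance neutral    y = refl
step-balance (up {h})   y = trans (x∙yz≈y∙xz (h + h) 2 y) (cong (_+ y) (sym (double-suc h)))
step-balance (down {h}) y = cong (_+ y) (double-suc h)
step-balance (bw {h})   y = x∙yz≈y∙xz (h + h) 1 y
step-balance (wb {h})   y = x∙yz≈y∙xz (h + h) 1 y

walk-balance : Walk h cs h′ → h + h + blacks cs ≡ h′ + h′ + whites cs
walk-balance []                           = refl
walk-balance {h = h} {h′ = h′} (_∷_ {h′ = h₁} {c = c} {cs = cs} s w) = begin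
  h + h + (blacksC c + blacks cs)   ≡⟨ step-balance s (blacks cs) ⟩
  whitesC c + (h₁ + h₁ + blacks cs) ≡⟨ cong (whitesC c +_) (walk-balance w) ⟩
  whitesC c + (h′ + h′ + whites cs) ≡⟨ x∙yz≈y∙xz (whitesC c) (h′ + h′) (whites cs) ⟩
  h′ + h′ + (whitesC c + whites cs) ∎
  where open ≡-Reasoning

PositiveFrom : ℕ → List Column → Set
PositiveFrom h cs = All (λ p → whites p ≤ h + h + blacks p) (inits cs)

step-positive : Step h c h′ → ∀ p → whites p ≤ h′ + h′ + blacks p ⇔ whites (c ∷ p) ≤ h + h + blacks (c ∷ p)
step-positive {c = c} s p = mk⇔
  (λ le → subst (whites (c ∷ p) ≤_) (sym balance) (+-monoʳ-≤ (whitesC c) le))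
  (λ le → +-cancelˡ-≤ (whitesC c) _ _ (subst (whites (c ∷ p) ≤_) balance le))
  where balance = step-balance s (blacks p)

walk-positive : Walk h cs h′ → PositiveFrom h cs
walk-positive []      = z≤n ∷ []
walk-positive (s ∷ w) = z≤n ∷ map⁺ (All.map (λ {p} → Equivalence.to (step-positive s p)) (walk-positive w))

positive-step : ∀ t b → whites (col t b ∷ []) ≤ h + h + blacks (col t b ∷ []) → ∃[ h′ ] Step h (col t b) h′
positive-step black black _ = _ , up
positive-step black white _ = _ , bw
positive-step white black _ = _ , wb
positive-step {suc h} white white _ = h , down

positive-walk : countXX cs ≡ 0 → PositiveFrom h cs → ∃[ h′ ] Walk h cs h′
positive-walk {[]}           _    _         = _ , []
positive-walk {col t b ∷ cs} noXX (_ ∷ pos) with map⁻ pos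
... | pos′@(p₁ ∷ _) with positive-step t b p₁
... | _ , s with positive-walk noXX (All.map (λ {p} → Equivalence.from (step-positive s p)) pos′)
... | h′ , w = h′ , s ∷ w

goodRun⇔walk : countXX cs ≡ 0 → GoodRun cs ⇔ Walk 0 cs 0
goodRun⇔walk noXX = mk⇔ to (λ w → walk-balance w , walk-positive w)
  where
  to : GoodRun _ → Walk 0 _ 0
  to (bal , pos) with positive-walk noXX pos
  ... | h′ , w = subst (Walk 0 _) (m+n≡0⇒m≡0 h′ (+-cancelʳ-≡ _ (h′ + h′) 0 (trans (sym (walk-balance w)) bal))) w

data XXView : List Column → Set where
  noXX : countXX cs ≡ 0 → XXView cs
  cut  : countXX cs ≡ 0 → XXView ds → XXView (cs ++ xx ∷ ds)

xxView : ∀ cs → XXView cs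
xxView []             = noXX refl
xxView (xx ∷ cs)      = cut {[]} refl (xxView cs)
xxView (col t b ∷ cs) with xxView cs
... | noXX e  = noXX e
... | cut {cs₁} e v = cut {col t b ∷ cs₁} e v

splitXX-noXX : countXX cs ≡ 0 → splitXX cs ≡ cs ∷ []
splitXX-noXX {[]}           _ = refl
splitXX-noXX {col t b ∷ cs} e with splitXX cs | splitXX-noXX {cs} e
... | _ | refl = refl

splitXX-xx : countXX cs ≡ 0 → splitXX (cs ++ xx ∷ ds) ≡ cs ∷ splitXX ds
splitXX-xx {[]}           _ = refl
splitXX-xx {col t b ∷ cs} {ds} e with splitXX (cs ++ xx ∷ ds) | splitXX-xx {cs} {ds} e
... | _ | refl = refl

goodRuns⇔walk : XXView cs → All GoodRun (splitXX cs) ⇔ Walk 0 cs 0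
goodRuns⇔walk (noXX {cs} e) rewrite splitXX-noXX {cs} e = mk⇔ (λ { (g ∷ []) → to g }) (λ w → from w ∷ [])
  where open Equivalence (goodRun⇔walk {cs} e)
goodRuns⇔walk (cut {cs} {ds} e v) rewrite splitXX-xx {cs} {ds} e = mk⇔
  (λ { (g ∷ gs) → walk-++⁺ (to g) (neutral ∷ Equivalence.to (goodRuns⇔walk v) gs) })
  (λ w → let w₁ , w₂ = walk-xx⁻ cs w in from w₁ ∷ Equivalence.from (goodRuns⇔walk v) w₂)
  where open Equivalence (goodRun⇔walk {cs} e)

afterFirstXX-xx : ∀ acc → countXX cs ≡ 0 → afterFirstXX acc (cs ++ xx ∷ ds) ≡ ds ++ reverse acc ++ cs
afterFirstXX-xx {[]} {ds} acc _ = cong (ds ++_) (sym (++-identityʳ (reverse acc)))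
afterFirstXX-xx {col t b ∷ cs} {ds} acc e = begin
  afterFirstXX (col t b ∷ acc) (cs ++ xx ∷ ds) ≡⟨ afterFirstXX-xx {cs} {ds} (col t b ∷ acc) e ⟩
  ds ++ reverse (col t b ∷ acc) ++ cs          ≡⟨ cong (λ r → ds ++ r ++ cs) (unfold-reverse (col t b) acc) ⟩
  ds ++ (reverse acc ++ col t b ∷ []) ++ cs    ≡⟨ cong (ds ++_) (++-assoc (reverse acc) _ cs) ⟩
  ds ++ reverse acc ++ col t b ∷ cs            ∎
  where open ≡-Reasoning

walk-after-xx⇔closed : Walk 0 (ds ++ cs) 0 ⇔ (∃[ h ] Walk h (cs ++ xx ∷ ds) h)
walk-after-xx⇔closed {ds} {cs} = mk⇔ to from
  where
  to : Walk 0 (ds ++ cs) 0 → ∃[ h ] Walk h (cs ++ xx ∷ ds) h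
  to w = let h , w₁ , w₂ = walk-++⁻ ds w in h , walk-++⁺ w₂ (neutral ∷ w₁)
  from : ∃[ h ] Walk h (cs ++ xx ∷ ds) h → Walk 0 (ds ++ cs) 0
  from (h , w) with walk-++⁻ cs w
  ... | _ , w₁ , neutral ∷ w₂ = walk-++⁺ w₂ w₁

goodRuns⇔closed : 1 ≤ countXX cs → All GoodRun (runs cs) ⇔ (∃[ h ] Walk h cs h)
goodRuns⇔closed {cs} x≥1 with xxView cs
... | noXX e = ⊥-elim (1+n≰n (subst (1 ≤_) e x≥1))
... | cut {cs₁} {ds} e _ =
  subst (λ rs → All GoodRun (splitXX rs) ⇔ (∃[ h ] Walk h (cs₁ ++ xx ∷ ds) h)) (sym (afterFirstXX-xx {cs₁} {ds} [] e))
    (⇔.trans (goodRuns⇔walk (xxView (ds ++ cs₁))) walk-after-xx⇔closed)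

Shape : Set
Shape = Bool × Bool

isBlack : Colour → Bool
isBlack black = true
isBlack white = false

shape : Column → Shape
shape xx        = false , false
shape (col t b) = isBlack t , isBlack b

ups downs : Vec Shape n → ℕ
ups   = countᵇ (uncurry _∧_)
downs = countᵇ (not ∘ uncurry _∨_)

column : ℕ → Shape → Column
column _       (true  , true)  = col black black
column _       (true  , false) = col black white
column _       (false , true)  = col white black
column zero    (false , false) = xx
column (suc _) (false , false) = col white white

next : ℕ → Shape → ℕ
next h       (true  , true)  = suc h
next h       (true  , false) = h
next h       (false , true)  = h
next zero    (false , false) = zero
next (suc h) (false , false) = h

decorate : ℕ → Vec Shape n → Vec Column n
decorate h []      = []
decorate h (x ∷ s) = column h x ∷ decorate (next h x) s

level : ℕ → Vec Shape n → ℕ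
level h []      = h
level h (x ∷ s) = level (next h x) s

step-column : Step h c h′ → column h (shape c) ≡ c × next h (shape c) ≡ h′
step-column neutral = refl , refl
step-column up      = refl , refl
step-column down    = refl , refl
step-column bw      = refl , refl
step-column wb      = refl , refl

column-step : ∀ h x → Step h (column h x) (next h x)
column-step _       (true  , true)  = up
column-step _       (true  , false) = bw
column-step _       (false , true)  = wb
column-step zero    (false , false) = neutral
column-step (suc _) (false , false) = down

shape-column : ∀ h x → shape (column h x) ≡ x
shape-column _       (true  , true)  = refl
shape-column _       (true  , false) = refl
shape-column _       (false , true)  = refl
shape-column zero    (false , false) = refl
shape-column (suc _) (false , false) = refl

walk⇒decorate : (c : Vec Column n) → Walk h (toList c) h′ → c ≡ decorate h (map shape c) × h′ ≡ level h (map shape c)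
walk⇒decorate []      []       = refl , refl
walk⇒decorate (x ∷ c) (st ∷ w) with step-column st
... | column≡x , next≡h₁ rewrite next≡h₁ =
  let c≡ , h′≡ = walk⇒decorate c w in cong₂ _∷_ (sym column≡x) c≡ , h′≡

decorate-walk : ∀ h (s : Vec Shape n) → Walk h (toList (decorate h s)) (level h s)
decorate-walk h []      = []
decorate-walk h (x ∷ s) = column-step h x ∷ decorate-walk (next h x) s

shape-decorate : ∀ h (s : Vec Shape n) → map shape (decorate h s) ≡ s
shape-decorate h []      = refl
shape-decorate h (x ∷ s) = cong₂ _∷_ (shape-column h x) (shape-decorate (next h x) s)

level-+ : ∀ a d (s : Vec Shape n) → level (a + d) s ≤ d + level a s
level-+ a       d       []                    = ≤-reflexive (+-comm a d)
level-+ a       d       ((true  , true)  ∷ s) = level-+ (suc a) d s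
level-+ a       d       ((true  , false) ∷ s) = level-+ a d s
level-+ a       d       ((false , true)  ∷ s) = level-+ a d s
level-+ zero    zero    ((false , false) ∷ s) = level-+ zero zero s
level-+ zero    (suc d) ((false , false) ∷ s) = m≤n⇒m≤1+n (level-+ zero d s)
level-+ (suc a) d       ((false , false) ∷ s) = level-+ a d s

-- The walks from a and from 1 + a + d come closer at the first ×× of the lower one.
level-suc-+ : ∀ a d (s : Vec Shape n) → 1 ≤ countXX (toList (decorate a s)) → level (suc a + d) s ≤ d + level a s
level-suc-+ _       _ []                    ()
level-suc-+ a       d ((true  , true)  ∷ s) x = level-suc-+ (suc a) d s x
level-suc-+ a       d ((true  , false) ∷ s) x = level-suc-+ a d s x
level-suc-+ a       d ((false , true)  ∷ s) x = level-suc-+ a d s x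
level-suc-+ zero    d ((false , false) ∷ s) _ = level-+ zero d s
level-suc-+ (suc a) d ((false , false) ∷ s) x = level-suc-+ a d s x

level-mono : ∀ {a b} → a ≤ b → ∀ (s : Vec Shape n) → level a s ≤ level b s
level-mono a≤b                []                    = a≤b
level-mono a≤b                ((true  , true)  ∷ s) = level-mono (s≤s a≤b) s
level-mono a≤b                ((true  , false) ∷ s) = level-mono a≤b s
level-mono a≤b                ((false , true)  ∷ s) = level-mono a≤b s
level-mono {b = zero}  z≤n    ((false , false) ∷ s) = level-mono z≤n s
level-mono {b = suc _} z≤n    ((false , false) ∷ s) = level-mono z≤n s
level-mono (s≤s a≤b)          ((false , false) ∷ s) = level-mono a≤b s

level-accounting : ∀ h (s : Vec Shape n) → downs s + level h s ≡ countXX (toList (decorate h s)) + (ups s + h)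
level-accounting h       []                    = refl
level-accounting h       ((true  , true)  ∷ s) =
  trans (level-accounting (suc h) s) (cong (countXX (toList (decorate (suc h) s)) +_) (+-suc (ups s) h))
level-accounting h       ((true  , false) ∷ s) = level-accounting h s
level-accounting h       ((false , true)  ∷ s) = level-accounting h s
level-accounting zero    ((false , false) ∷ s) = cong suc (level-accounting zero s)
level-accounting (suc h) ((false , false) ∷ s) = begin
  suc (downs s + level h s) ≡⟨ cong suc (level-accounting h s) ⟩
  suc (x + (ups s + h))     ≡⟨ +-suc x (ups s + h) ⟨
  x + suc (ups s + h)       ≡⟨ cong (x +_) (+-suc (ups s) h) ⟨
  x + (ups s + suc h)       ∎
  where open ≡-Reasoning
        x = countXX (toList (decorate h s))

countXX-decorate-above-downs : ∀ (s : Vec Shape n) → downs s ≤ h → countXX (toList (decorate h s)) ≡ 0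
countXX-decorate-above-downs []                    _       = refl
countXX-decorate-above-downs ((true  , true)  ∷ s) le      = countXX-decorate-above-downs s (m≤n⇒m≤1+n le)
countXX-decorate-above-downs ((true  , false) ∷ s) le      = countXX-decorate-above-downs s le
countXX-decorate-above-downs ((false , true)  ∷ s) le      = countXX-decorate-above-downs s le
countXX-decorate-above-downs ((false , false) ∷ s) (s≤s le) = countXX-decorate-above-downs s le

fixed-level-countXX : ∀ (s : Vec Shape n) → level h s ≡ h → countXX (toList (decorate h s)) + ups s ≡ downs s
fixed-level-countXX {h = h} s fixed = sym (+-cancelʳ-≡ h _ _ (begin
  downs s + h                 ≡⟨ cong (downs s +_) fixed ⟨
  downs s + level h s         ≡⟨ level-accounting h s ⟩
  x + (ups s + h)             ≡⟨ +-assoc x (ups s) h ⟨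
  x + ups s + h               ∎))
  where open ≡-Reasoning
        x = countXX (toList (decorate h s))

fixed-level : ∀ (s : Vec Shape n) → ups s ≤ downs s → ∃[ h ] level h s ≡ h
fixed-level s ups≤downs = search (downs s) (subst (_≤ downs s) (sym level≡ups) ups≤downs)
  where
  -- The invariant level h s ≤ h survives decreasing h, by monotonicity of level.
  search : ∀ h → level h s ≤ h → ∃[ h ] level h s ≡ h
  search zero    le = zero , n≤0⇒n≡0 le
  search (suc h) le with m≤n⇒m<n∨m≡n le
  ... | inj₂ fixed    = suc h , fixed
  ... | inj₁ (s≤s lt) = search h (≤-trans (level-mono (n≤1+n h) s) lt)
  level≡ups : level (downs s) s ≡ ups s
  level≡ups = +-cancelˡ-≡ (downs s) _ _ (begin
    downs s + level (downs s) s                       ≡⟨ level-accounting (downs s) s ⟩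
    countXX (toList (decorate (downs s) s)) + (u + d) ≡⟨ cong (_+ (u + d)) (countXX-decorate-above-downs s ≤-refl) ⟩
    u + d                                             ≡⟨ +-comm u d ⟩
    d + u                                             ∎)
    where open ≡-Reasoning
          u = ups s; d = downs s

no-fixed-level-above : ∀ {a b} (s : Vec Shape n) → level a s ≡ a → 1 ≤ countXX (toList (decorate a s)) →
                       a < b → level b s ≢ b
no-fixed-level-above {a = a} {b} s fixed-a xx-a a<b fixed-b = 1+n≰n (begin
  suc (a + d)          ≡⟨ b≡ ⟩
  b                    ≡⟨ fixed-b ⟨
  level b s            ≡⟨ cong (λ z → level z s) b≡ ⟨
  level (suc a + d) s  ≤⟨ level-suc-+ a d s xx-a ⟩
  d + level a s        ≡⟨ cong (d +_) fixed-a ⟩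
  d + a                ≡⟨ +-comm d a ⟩
  a + d                ∎)
  where open ≤-Reasoning
        d = b ∸ suc a
        b≡ : suc a + d ≡ b
        b≡ = m+[n∸m]≡n a<b

fixed-level-unique : ∀ {a b} (s : Vec Shape n) → level a s ≡ a → level b s ≡ b →
                     1 ≤ countXX (toList (decorate a s)) → 1 ≤ countXX (toList (decorate b s)) → a ≡ b
fixed-level-unique {a = a} {b} s fixed-a fixed-b xx-a xx-b with <-cmp a b
... | tri< a<b _ _ = ⊥-elim (no-fixed-level-above s fixed-a xx-a a<b fixed-b)
... | tri≈ _ a≡b _ = a≡b
... | tri> _ _ b<a = ⊥-elim (no-fixed-level-above s fixed-b xx-b b<a fixed-a)

decorate-unique : ∀ (c : Vec Column n) → ∃[ a ] Walk a (toList c) a → 1 ≤ countXX (toList c) →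
                  level h (map shape c) ≡ h → 1 ≤ countXX (toList (decorate h (map shape c))) →
                  decorate h (map shape c) ≡ c
decorate-unique {h = h} c (a , w) xx-c fixed xx-h with walk⇒decorate c w
... | c≡ , a≡ = trans (cong (λ z → decorate z (map shape c)) h≡a) (sym c≡)
  where
  h≡a : h ≡ a
  h≡a = fixed-level-unique (map shape c) fixed (sym a≡) xx-h (subst (λ z → 1 ≤ countXX (toList z)) c≡ xx-c)

topBlacks-shape : ∀ (c : Vec Column n) → topBlacks (toList c) ≡ countᵇ id (map proj₁ (map shape c))
topBlacks-shape []                = refl
topBlacks-shape (xx ∷ c)          = topBlacks-shape c
topBlacks-shape (col black _ ∷ c) = cong suc (topBlacks-shape c)
topBlacks-shape (col white _ ∷ c) = topBlacks-shape c

-- Each step changes the level by [bottom particle black] − [top particle white].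
walk-bottomBlacks : ∀ (c : Vec Column n) → Walk h (toList c) h′ →
                    countᵇ id (map proj₂ (map shape c)) + h ≡ topWhites (toList c) + h′
walk-bottomBlacks []      []                  = refl
walk-bottomBlacks (_ ∷ c) (neutral ∷ w)       = walk-bottomBlacks c w
walk-bottomBlacks (_ ∷ c) (up {h} ∷ w)        = trans (sym (+-suc _ h)) (walk-bottomBlacks c w)
walk-bottomBlacks (_ ∷ c) (down {h} ∷ w)      = trans (+-suc _ h) (cong suc (walk-bottomBlacks c w))
walk-bottomBlacks (_ ∷ c) (bw ∷ w)            = walk-bottomBlacks c w
walk-bottomBlacks (_ ∷ c) (wb ∷ w)            = cong suc (walk-bottomBlacks c w)

closed-bottomBlacks : ∀ (c : Vec Column n) → ∃[ h ] Walk h (toList c) h →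
                      countᵇ id (map proj₂ (map shape c)) ≡ topWhites (toList c)
closed-bottomBlacks c (h , w) = +-cancelʳ-≡ h _ _ (walk-bottomBlacks c w)

shape-counts : ∀ (s : Vec Shape n) → countᵇ id (map proj₁ s) + countᵇ id (map proj₂ s) + downs s ≡ n + ups s
shape-counts []                    = refl
shape-counts ((true  , true)  ∷ s) = cong suc (begin
  t + suc b + d   ≡⟨ cong (_+ d) (+-suc t b) ⟩
  suc (t + b + d) ≡⟨ cong suc (shape-counts s) ⟩
  suc (_ + ups s) ≡⟨ +-suc _ (ups s) ⟨
  _ + suc (ups s) ∎)
  where open ≡-Reasoning
        t = countᵇ id (map proj₁ s); b = countᵇ id (map proj₂ s); d = downs s
shape-counts ((true  , false) ∷ s) = cong suc (shape-counts s)
shape-counts ((false , true)  ∷ s) = trans (cong (_+ downs s) (+-suc _ _)) (cong suc (shape-counts s))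
shape-counts ((false , false) ∷ s) = trans (+-suc _ (downs s)) (cong suc (shape-counts s))

Shapes : ℕ → ℕ → ℕ → Set
Shapes n k m = Σ (Vec Shape n) (λ s → countᵇ id (map proj₁ s) ≡ k × countᵇ id (map proj₂ s) ≡ m)

counts-irrelevant : ∀ {a b k m : ℕ} (u v : a ≡ k × b ≡ m) → u ≡ v
counts-irrelevant (p , q) (p′ , q′) = cong₂ _,_ (≡-irrelevant p p′) (≡-irrelevant q q′)

Shapes↔Choose² : ∀ {n k m} → Shapes n k m ↔ (Choose n k × Choose n m)
Shapes↔Choose² = mk↔ₛ′ unzip′ zip′ unzip∘zip zip∘unzip
  where
  unzip′ : Shapes _ _ _ → Choose _ _ × Choose _ _
  unzip′ (s , p , q) = (map proj₁ s , p) , (map proj₂ s , q)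
  zip′ : Choose _ _ × Choose _ _ → Shapes _ _ _
  zip′ ((a , p) , (b , q)) = zip a b , trans (cong (countᵇ id) (map-proj₁-zip a b)) p
                                     , trans (cong (countᵇ id) (map-proj₂-zip a b)) q
  unzip∘zip : ∀ x → unzip′ (zip′ x) ≡ x
  unzip∘zip ((a , _) , (b , _)) =
    cong₂ _,_ (Σ-≡-irrelevant ≡-irrelevant (map-proj₁-zip a b)) (Σ-≡-irrelevant ≡-irrelevant (map-proj₂-zip a b))
  zip∘unzip : ∀ x → zip′ (unzip′ x) ≡ x
  zip∘unzip (s , _) = Σ-≡-irrelevant counts-irrelevant (trans (sym (map-<,>-zip proj₁ proj₂ s)) (map-id s))

InOmega-irrelevant : ∀ {n k ℓ m} {c : Config n} (u v : InOmega n k ℓ m c) → u ≡ v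
InOmega-irrelevant (a , b , c , d) (a′ , b′ , c′ , d′) =
  cong₂ _,_ (≡-irrelevant a a′) (cong₂ _,_ (≡-irrelevant b b′) (cong₂ _,_ (≡-irrelevant c c′)
    (All.irrelevant (λ (p , q) (p′ , q′) → cong₂ _,_ (≡-irrelevant p p′) (All.irrelevant ≤-irrelevant q q′)) d d′)))

module _ {n k ℓ m : ℕ} (ℓ≥1 : ℓ ≥ 1) (k+ℓ+m≡n : k + ℓ + m ≡ n) where

  shapes-downs : ((s , _) : Shapes n k m) → downs s ≡ ℓ + ups s
  shapes-downs (s , refl , refl) = +-cancelˡ-≡ (k + m) _ _ (begin
    k + m + downs s       ≡⟨ shape-counts s ⟩
    n + ups s             ≡⟨ cong (_+ ups s) k+ℓ+m≡n ⟨
    k + ℓ + m + ups s     ≡⟨ rearrange k ℓ m (ups s) ⟩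
    k + m + (ℓ + ups s)   ∎)
    where open ≡-Reasoning
          rearrange : ∀ k ℓ m u → k + ℓ + m + u ≡ k + m + (ℓ + u)
          rearrange = solve-∀

  ≡ℓ⇒≥1 : ∀ {a} → a ≡ ℓ → 1 ≤ a
  ≡ℓ⇒≥1 a≡ℓ = subst (1 ≤_) (sym a≡ℓ) ℓ≥1

  fixed-countXX : ((s , _) : Shapes n k m) → level h s ≡ h → countXX (toList (decorate h s)) ≡ ℓ
  fixed-countXX x@(s , _) fixed = +-cancelʳ-≡ (ups s) _ _ (trans (fixed-level-countXX s fixed) (shapes-downs x))

  closed-walk : (c : Config n) → InOmega n k ℓ m c → ∃[ h ] Walk h (toList c) h
  closed-walk c (cx , _ , _ , good) = Equivalence.to (goodRuns⇔closed (≡ℓ⇒≥1 cx)) good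

  toShapes : Omega n k ℓ m → Shapes n k m
  toShapes (c , ω@(_ , tb , tw , _)) =
    map shape c , trans (sym (topBlacks-shape c)) tb , trans (closed-bottomBlacks c (closed-walk c ω)) tw

  fixed-point : ((s , _) : Shapes n k m) → ∃[ h ] level h s ≡ h
  fixed-point x@(s , _) = fixed-level s (subst (ups s ≤_) (sym (shapes-downs x)) (m≤n+m (ups s) ℓ))

  decorate-InOmega : ((s , _) : Shapes n k m) → level h s ≡ h → InOmega n k ℓ m (decorate h s)
  decorate-InOmega {h} x@(s , p , q) fixed = cx , tb , tw , good
    where
    config = decorate h s
    closed : Walk h (toList config) h
    closed = subst (Walk h _) fixed (decorate-walk h s)
    cx = fixed-countXX x fixed
    tb = trans (topBlacks-shape config) (trans (cong (countᵇ id ∘ map proj₁) (shape-decorate h s)) p)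
    tw = trans (sym (closed-bottomBlacks config (h , closed)))
               (trans (cong (countᵇ id ∘ map proj₂) (shape-decorate h s)) q)
    good = Equivalence.from (goodRuns⇔closed (≡ℓ⇒≥1 cx)) (h , closed)

  fromShapes : Shapes n k m → Omega n k ℓ m
  fromShapes x@(s , _) = let h , fixed = fixed-point x in decorate h s , decorate-InOmega x fixed

  toShapes∘fromShapes : ∀ x → toShapes (fromShapes x) ≡ x
  toShapes∘fromShapes (s , _) = Σ-≡-irrelevant counts-irrelevant (shape-decorate _ s)

  fromShapes∘toShapes : ∀ x → fromShapes (toShapes x) ≡ x
  fromShapes∘toShapes x@(c , ω@(cx , _)) = Σ-≡-irrelevant (λ {c} → InOmega-irrelevant {c = c})
    (decorate-unique c (closed-walk c ω) (≡ℓ⇒≥1 cx) fixed (≡ℓ⇒≥1 (fixed-countXX (toShapes x) fixed)))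
    where fixed = proj₂ (fixed-point (toShapes x))

  Omega↔Shapes : Omega n k ℓ m ↔ Shapes n k m
  Omega↔Shapes = mk↔ₛ′ toShapes fromShapes toShapes∘fromShapes fromShapes∘toShapes

lemma8 : (n k ℓ m : ℕ) → n ≥ 1 → ℓ ≥ 1 → k + ℓ + m ≡ n
    → Omega n k ℓ m ↔ Fin ((n C k) * (n C m))
-- n ≥ 1 follows from ℓ ≥ 1.
lemma8 n k ℓ m _ ℓ≥1 k+ℓ+m≡n =
  ↔-trans (Omega↔Shapes ℓ≥1 k+ℓ+m≡n)
    (↔-trans Shapes↔Choose² (↔-trans (Choose↔Fin n k ×-↔ Choose↔Fin n m) (↔-sym *↔×)))
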